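{- Let $G=(V,E)$ be a simple graph whose adjacency matrix $A_G$ has nullity one. Suppose there exist a nonzero $x\in N(A_G)$ and a non-empty subset $S\subseteq V$ with $\sum_{v\in S}x_v=0$ and $|S|\notin\{\deg(v): v\in V\}$. Then $G$ satisfies the ACK property, i.e. there is a nonzero $\{0,1\}$-vector in the row space of $A_G$ over $\mathbb{R}$ that is not a row of $A_G$.
   Context: $A_G$ is the adjacency matrix of $G$ over $\mathbb{R}$; $N(A_G)$ its null space; $x_v$ is the coordinate of $x$ indexed by vertex $v$.
   Formalization: The null vector x has rational entries, and the nullity of $A_G$ and its row space are taken over ℚ rather than ℝ. -}

module Defs where

open import Data.Nat using (ℕ; zero; suc)
open import Data.Bool using (Bool; true; false; if_then_else_)
open import Data.Fin using (Fin; zero; suc)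
open import Data.Fin.Subset using (Subset; Side; inside; outside; ∣_∣)
open import Data.Vec using (tabulate; lookup)
open import Data.Rational using (ℚ; 0ℚ; 1ℚ; _+_; _*_)
open import Data.Product using (Σ; _×_; ∃)
open import Relation.Binary.PropositionalEquality using (_≡_; _≢_)
open import Relation.Nullary using (¬_)

record SimpleGraph (n : ℕ) : Set where
  field
    adj   : Fin n → Fin n → Bool
    sym   : ∀ u v → adj u v ≡ adj v u
    loopless : ∀ v → adj v v ≡ false

open SimpleGraph public

sumℚ : (n : ℕ) → (Fin n → ℚ) → ℚ
sumℚ zero    f = 0ℚ
sumℚ (suc n) f = f zero + sumℚ n (λ i → f (suc i))

Vector : ℕ → Set
Vector n = Fin n → ℚ

adjMatrix : ∀ {n} → SimpleGraph n → Fin n → Fin n → ℚ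
adjMatrix G i j = if adj G i j then 1ℚ else 0ℚ

mulVec : ∀ {n} → SimpleGraph n → Vector n → Vector n
mulVec {n} G x i = sumℚ n (λ j → adjMatrix G i j * x j)

zeroVec : ∀ {n} → Vector n
zeroVec _ = 0ℚ

IsZeroVec : ∀ {n} → Vector n → Set
IsZeroVec x = ∀ i → x i ≡ 0ℚ

InNullSpace : ∀ {n} → SimpleGraph n → Vector n → Set
InNullSpace G x = ∀ i → mulVec G x i ≡ 0ℚ

NullityOne : ∀ {n} → SimpleGraph n → Set
NullityOne G =
  Σ (Vector _) λ y → InNullSpace G y × ¬ IsZeroVec y ×
    (∀ z → InNullSpace G z → ∃ λ (c : ℚ) → ∀ i → z i ≡ c * y i)

InRowSpace : ∀ {n} → SimpleGraph n → Vector n → Set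
InRowSpace {n} G w = ∃ λ (c : Vector n) → ∀ j → w j ≡ sumℚ n (λ i → c i * adjMatrix G i j)

IsZeroOneVec : ∀ {n} → Vector n → Set
IsZeroOneVec w = ∀ j → (w j ≡ 0ℚ) Data.Sum.⊎ (w j ≡ 1ℚ)
  where import Data.Sum

IsRow : ∀ {n} → SimpleGraph n → Vector n → Fin n → Set
IsRow G w i = ∀ j → w j ≡ adjMatrix G i j

ACK : ∀ {n} → SimpleGraph n → Set
ACK G = ∃ λ w → IsZeroOneVec w × ¬ IsZeroVec w × InRowSpace G w × (∀ i → ¬ IsRow G w i)

neighbourhood : ∀ {n} → SimpleGraph n → Fin n → Subset n
neighbourhood G v = tabulate (λ u → if adj G v u then inside else outside)

deg : ∀ {n} → SimpleGraph n → Fin n → ℕ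
deg G v = ∣ neighbourhood G v ∣

sideVal : Side → ℚ → ℚ
sideVal inside  q = q
sideVal outside q = 0ℚ

sumOver : ∀ {n} → Subset n → Vector n → ℚ
sumOver {n} S x = sumℚ n (λ v → sideVal (lookup S v) (x v))

{-# OPTIONS --safe #-}
module Submission where

-- The indicator vector 1_S is a nonzero {0,1}-vector, and it is not a row of A_G: rows are
-- indicators of neighbourhoods, and |S| is no degree. It lies in the row space because over a
-- field the row space is the orthogonal complement of the kernel, and N(A_G) is spanned by x,
-- to which 1_S is orthogonal since 1_S · x = Σ_{v ∈ S} x_v = 0.

open import Defs hiding (sym)
open import Data.Nat using (ℕ; zero; suc)
open import Data.Bool using (true; false; if_then_else_)
open import Data.Empty using (⊥-elim)
open import Data.Fin using (Fin; zero; suc)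
open import Data.Fin.Properties using (all?; ¬∀⟶∃¬)
open import Data.Fin.Subset using (Subset; Nonempty; ∣_∣; inside; outside)
open import Data.Product using (_×_; _,_; ∃)
open import Data.Rational using (ℚ; 0ℚ; 1ℚ; _+_; _*_; -_; 1/_; _≟_; NonZero; ≢-nonZero)
open import Data.Rational.Properties
  using (+-*-ring; *-1-commutativeMonoid; *-comm; *-assoc; *-distribˡ-+; *-zeroˡ; *-zeroʳ; *-identityˡ; *-identityʳ; *-inverseˡ; +-identityˡ; +-identityʳ; 1≢0)
open import Data.Rational.Solver using (module +-*-Solver)
open import Data.Sum using (_⊎_; inj₁; inj₂)
open import Data.Vec using (lookup)
open import Data.Vec.Functional using (head; tail)
open import Data.Vec.Properties using ([]=⇒lookup; tabulate∘lookup; tabulate-cong)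
open import Algebra.Bundles using (Ring; CommutativeMonoid)
open import Algebra.Properties.CommutativeSemigroup (CommutativeMonoid.commutativeSemigroup *-1-commutativeMonoid)
  using (x∙yz≈y∙xz)
open import Algebra.Properties.Semiring.Sum (Ring.semiring +-*-ring)
  using (sum; sum-syntax; sum-cong-≗; sum-replicate-zero; ∑-distrib-+; *-distribˡ-sum)
open import Relation.Binary.PropositionalEquality using (_≡_; _≢_; refl; sym; trans; cong; cong₂; module ≡-Reasoning)
open import Relation.Nullary using (¬_; yes; no)
open +-*-Solver using (solve; con; _:+_; _:*_; :-_; _:=_)

private
  variable
    m n : ℕ

sumℚ≡sum : ∀ n (f : Vector n) → sumℚ n f ≡ sum f
sumℚ≡sum zero    f = refl
sumℚ≡sum (suc n) f = cong (f zero +_) (sumℚ≡sum n (tail f))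

p≢0⇒p*q≡0⇒q≡0 : ∀ {p q} → p ≢ 0ℚ → p * q ≡ 0ℚ → q ≡ 0ℚ
p≢0⇒p*q≡0⇒q≡0 {p} {q} p≢0 pq≡0 = begin
  q                ≡⟨ sym (*-identityˡ q) ⟩
  1ℚ * q           ≡⟨ cong (_* q) (sym (*-inverseˡ p)) ⟩
  (1/ p * p) * q   ≡⟨ *-assoc (1/ p) p q ⟩
  1/ p * (p * q)   ≡⟨ cong (1/ p *_) pq≡0 ⟩
  1/ p * 0ℚ        ≡⟨ *-zeroʳ (1/ p) ⟩
  0ℚ               ∎
  where
  open ≡-Reasoning
  instance
    p-nonZero : NonZero p
    p-nonZero = ≢-nonZero p≢0

infixl 6 _+ᵛ_
infixr 7 _*ᵛ_
infix  8 _·_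

_+ᵛ_ : Vector n → Vector n → Vector n
(u +ᵛ v) j = u j + v j

_*ᵛ_ : ℚ → Vector n → Vector n
(t *ᵛ v) j = t * v j

_·_ : Vector n → Vector n → ℚ
u · v = sum (λ j → u j * v j)

·-comm : (u v : Vector n) → u · v ≡ v · u
·-comm u v = sum-cong-≗ (λ j → *-comm (u j) (v j))

·-congʳ : ∀ (u : Vector n) {v w} → (∀ j → v j ≡ w j) → u · v ≡ u · w
·-congʳ u v≗w = sum-cong-≗ (λ j → cong (u j *_) (v≗w j))

·-distribˡ-+ᵛ : (u v w : Vector n) → u · (v +ᵛ w) ≡ u · v + u · w
·-distribˡ-+ᵛ u v w = trans (sum-cong-≗ (λ j → *-distribˡ-+ (u j) (v j) (w j)))
                             (∑-distrib-+ (λ j → u j * v j) (λ j → u j * w j))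

·-*ᵛ : ∀ (u : Vector n) t v → u · (t *ᵛ v) ≡ t * (u · v)
·-*ᵛ u t v = trans (sum-cong-≗ (λ j → x∙yz≈y∙xz (u j) t (v j))) (sym (*-distribˡ-sum t (λ j → u j * v j)))

·-linearʳ : ∀ (u v : Vector n) t w → u · (v +ᵛ t *ᵛ w) ≡ u · v + t * (u · w)
·-linearʳ u v t w = trans (·-distribˡ-+ᵛ u v (t *ᵛ w)) (cong (u · v +_) (·-*ᵛ u t w))

δ : Fin n → Vector n
δ zero    zero    = 1ℚ
δ zero    (suc _) = 0ℚ
δ (suc _) zero    = 0ℚ
δ (suc i) (suc j) = δ i j

·-δ : ∀ (u : Vector n) j → u · δ j ≡ u j
·-δ {suc n} u zero = begin
  u zero * 1ℚ + ∑[ k < n ] (u (suc k) * 0ℚ)  ≡⟨ cong₂ _+_ (*-identityʳ (u zero)) (sum-cong-≗ (λ k → *-zeroʳ (u (suc k)))) ⟩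
  u zero + ∑[ k < n ] 0ℚ                     ≡⟨ cong (u zero +_) (sum-replicate-zero n) ⟩
  u zero + 0ℚ                                ≡⟨ +-identityʳ (u zero) ⟩
  u zero                                     ∎
  where open ≡-Reasoning
·-δ {suc n} u (suc j) = trans (cong₂ _+_ (*-zeroʳ (u zero)) (·-δ (tail u) j)) (+-identityˡ (u (suc j)))

Matrix : ℕ → ℕ → Set
Matrix m n = Fin m → Vector n

InKernel : Matrix m n → Vector n → Set
InKernel M z = ∀ i → M i · z ≡ 0ℚ

InRowSpan : Matrix m n → Vector n → Set
InRowSpan {m} M b = ∃ λ (c : Vector m) → ∀ j → b j ≡ ∑[ i < m ] (c i * M i j)

Separated : Matrix m n → Vector n → Set
Separated M b = ∃ λ z → InKernel M z × b · z ≢ 0ℚ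

inKernel-+ᵛ-*ᵛ : ∀ (M : Matrix m n) {u v : Vector n} t →
                 InKernel M u → InKernel M v → InKernel M (u +ᵛ t *ᵛ v)
inKernel-+ᵛ-*ᵛ M {u} {v} t Mu≡0 Mv≡0 i = begin
  M i · (u +ᵛ t *ᵛ v)        ≡⟨ ·-linearʳ (M i) u t v ⟩
  M i · u + t * (M i · v)    ≡⟨ cong₂ (λ a b → a + t * b) (Mu≡0 i) (Mv≡0 i) ⟩
  0ℚ + t * 0ℚ                ≡⟨ solve 1 (λ t → con 0ℚ :+ t :* con 0ℚ := con 0ℚ) refl t ⟩
  0ℚ                         ∎
  where open ≡-Reasoning

inKernel-*ᵛ : ∀ (M : Matrix m n) {v : Vector n} t → InKernel M v → InKernel M (t *ᵛ v)
inKernel-*ᵛ M {v} t Mv≡0 i = trans (·-*ᵛ (M i) t v) (trans (cong (t *_) (Mv≡0 i)) (*-zeroʳ t))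

inKernel-head-tail : (M : Matrix (suc m) n) {z : Vector n} →
                     head M · z ≡ 0ℚ → InKernel (tail M) z → InKernel M z
inKernel-head-tail M M₀z≡0 _       zero    = M₀z≡0
inKernel-head-tail M _     tailz≡0 (suc i) = tailz≡0 i

inRowSpan-tail : (M : Matrix (suc m) n) {b : Vector n} → InRowSpan (tail M) b → InRowSpan M b
inRowSpan-tail {m} M (c , b≡cM) = (λ { zero → 0ℚ ; (suc i) → c i }) , λ j →
  let cM = ∑[ i < m ] (c i * M (suc i) j) in
  trans (b≡cM j) (sym (trans (cong (_+ cM) (*-zeroˡ (M zero j))) (+-identityˡ cM)))

inRowSpan-shift : ∀ (M : Matrix (suc m) n) {b : Vector n} t →
                  InRowSpan (tail M) (b +ᵛ t *ᵛ head M) → InRowSpan M b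
inRowSpan-shift M {b} t (c , b′≡cM) = (λ { zero → - t ; (suc i) → c i }) , λ j →
  trans (unshift (b j) t (M zero j)) (cong (- t * M zero j +_) (b′≡cM j))
  where
  unshift : ∀ b t a → b ≡ - t * a + (b + t * a)
  unshift = solve 3 (λ b t a → b := (:- t) :* a :+ (b :+ t :* a)) refl

·-project : ∀ (a p v : Vector n) → a · p ≡ 1ℚ → a · (v +ᵛ (- (a · v)) *ᵛ p) ≡ 0ℚ
·-project a p v a·p≡1 = begin
  a · (v +ᵛ (- (a · v)) *ᵛ p)    ≡⟨ ·-linearʳ a v (- (a · v)) p ⟩
  a · v + (- (a · v)) * (a · p)  ≡⟨ cong (λ x → a · v + (- (a · v)) * x) a·p≡1 ⟩
  a · v + (- (a · v)) * 1ℚ       ≡⟨ solve 1 (λ x → x :+ (:- x) :* con 1ℚ := con 0ℚ) refl (a · v) ⟩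
  0ℚ                             ∎
  where open ≡-Reasoning

·-project-transpose : ∀ (a b p v : Vector n) →
                      b · (v +ᵛ (- (a · v)) *ᵛ p) ≡ (b +ᵛ (- (b · p)) *ᵛ a) · v
·-project-transpose a b p v = begin
  b · (v +ᵛ (- (a · v)) *ᵛ p)    ≡⟨ ·-linearʳ b v (- (a · v)) p ⟩
  b · v + (- (a · v)) * (b · p)  ≡⟨ solve 3 (λ x y z → x :+ (:- y) :* z := x :+ (:- z) :* y) refl (b · v) (a · v) (b · p) ⟩
  b · v + (- (b · p)) * (a · v)  ≡⟨ cong₂ (λ x y → x + (- (b · p)) * y) (·-comm b v) (·-comm a v) ⟩
  v · b + (- (b · p)) * (v · a)  ≡⟨ sym (·-linearʳ v b (- (b · p)) a) ⟩
  v · (b +ᵛ (- (b · p)) *ᵛ a)    ≡⟨ ·-comm v (b +ᵛ (- (b · p)) *ᵛ a) ⟩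
  (b +ᵛ (- (b · p)) *ᵛ a) · v    ∎
  where open ≡-Reasoning

eliminate-pivot : ∀ (M : Matrix (suc m) n) {p b : Vector n} →
                  InKernel (tail M) p → head M · p ≡ 1ℚ →
                  let b′ = b +ᵛ (- (b · p)) *ᵛ head M in
                  InRowSpan (tail M) b′ ⊎ Separated (tail M) b′ → InRowSpan M b ⊎ Separated M b
eliminate-pivot M {p} {b} _ _ (inj₁ b′∈span) = inj₁ (inRowSpan-shift M (- (b · p)) b′∈span)
eliminate-pivot M {p} {b} p∈ker M₀p≡1 (inj₂ (v , v∈ker , b′v≢0)) =
  inj₂ (v′ , v′∈ker , λ bv′≡0 → b′v≢0 (trans (sym (·-project-transpose (head M) b p v)) bv′≡0))
  where
  v′ : Vector _
  v′ = v +ᵛ (- (head M · v)) *ᵛ p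
  v′∈ker : InKernel M v′
  v′∈ker = inKernel-head-tail M (·-project (head M) p v M₀p≡1)
                                (inKernel-+ᵛ-*ᵛ (tail M) (- (head M · v)) v∈ker p∈ker)

-- Gaussian elimination: a vector separating b from the tail rows is, unless it is already
-- orthogonal to the head row, a pivot that eliminates the head row.
inRowSpan⊎separated : ∀ (M : Matrix m n) b → InRowSpan M b ⊎ Separated M b
inRowSpan⊎separated {zero} {n} M b with all? (λ j → b j ≟ 0ℚ)
... | yes b≡0 = inj₁ ((λ ()) , b≡0)
... | no  b≢0 with ¬∀⟶∃¬ n _ (λ j → b j ≟ 0ℚ) b≢0
...   | j , bj≢0 = inj₂ (δ j , (λ ()) , λ b·δ≡0 → bj≢0 (trans (sym (·-δ b j)) b·δ≡0))
inRowSpan⊎separated {suc m} M b with inRowSpan⊎separated (tail M) b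
... | inj₁ b∈span = inj₁ (inRowSpan-tail M b∈span)
... | inj₂ (z , z∈ker , bz≢0) with head M · z ≟ 0ℚ
...   | yes M₀z≡0 = inj₂ (z , inKernel-head-tail M M₀z≡0 z∈ker , bz≢0)
...   | no  M₀z≢0 = eliminate-pivot M p∈ker M₀p≡1 (inRowSpan⊎separated (tail M) _)
  where
  instance
    M₀z-nonZero : NonZero (head M · z)
    M₀z-nonZero = ≢-nonZero M₀z≢0
  p : Vector _
  p = 1/ (head M · z) *ᵛ z
  p∈ker : InKernel (tail M) p
  p∈ker = inKernel-*ᵛ (tail M) (1/ (head M · z)) z∈ker
  M₀p≡1 : head M · p ≡ 1ℚ
  M₀p≡1 = trans (·-*ᵛ (head M) (1/ (head M · z)) z) (*-inverseˡ (head M · z))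

⊥kernel⇒inRowSpan : ∀ (M : Matrix m n) b → (∀ z → InKernel M z → b · z ≡ 0ℚ) → InRowSpan M b
⊥kernel⇒inRowSpan M b b⊥ker with inRowSpan⊎separated M b
... | inj₁ b∈span             = b∈span
... | inj₂ (z , z∈ker , bz≢0) = ⊥-elim (bz≢0 (b⊥ker z z∈ker))

inKernel⇒inNullSpace : (G : SimpleGraph n) {z : Vector n} →
                       InKernel (adjMatrix G) z → InNullSpace G z
inKernel⇒inNullSpace {n} G {z} Az≡0 i = trans (sumℚ≡sum n (λ j → adjMatrix G i j * z j)) (Az≡0 i)

inRowSpan⇒inRowSpace : (G : SimpleGraph n) {w : Vector n} →
                       InRowSpan (adjMatrix G) w → InRowSpace G w
inRowSpan⇒inRowSpace {n} G (c , w≡cA) =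
  c , λ j → trans (w≡cA j) (sym (sumℚ≡sum n (λ i → c i * adjMatrix G i j)))

nullityOne⇒⊥nullSpace : (G : SimpleGraph n) → NullityOne G → {x : Vector n} →
                        ¬ IsZeroVec x → InNullSpace G x → (w : Vector n) → w · x ≡ 0ℚ →
                        ∀ z → InNullSpace G z → w · z ≡ 0ℚ
nullityOne⇒⊥nullSpace G (y , _ , _ , multiple-of-y) {x} x≢0 x∈N w wx≡0 z z∈N
  with multiple-of-y x x∈N | multiple-of-y z z∈N
... | cx , x≡cxy | cz , z≡czy = begin
  w · z          ≡⟨ w·-multiple z cz z≡czy ⟩
  cz * (w · y)   ≡⟨ cong (cz *_) wy≡0 ⟩
  cz * 0ℚ        ≡⟨ *-zeroʳ cz ⟩
  0ℚ             ∎
  where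
  open ≡-Reasoning
  w·-multiple : ∀ v c → (∀ i → v i ≡ c * y i) → w · v ≡ c * (w · y)
  w·-multiple v c v≡cy = trans (·-congʳ w v≡cy) (·-*ᵛ w c y)
  cx≢0 : cx ≢ 0ℚ
  cx≢0 cx≡0 = x≢0 (λ i → trans (x≡cxy i) (trans (cong (_* y i) cx≡0) (*-zeroˡ (y i))))
  wy≡0 : w · y ≡ 0ℚ
  wy≡0 = p≢0⇒p*q≡0⇒q≡0 cx≢0 (trans (sym (w·-multiple x cx x≡cxy)) wx≡0)

indicator : Subset n → Vector n
indicator S v = sideVal (lookup S v) 1ℚ

indicator-isZeroOne : (S : Subset n) → IsZeroOneVec (indicator S)
indicator-isZeroOne S j with lookup S j
... | inside  = inj₂ refl
... | outside = inj₁ refl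

indicator-nonzero : {S : Subset n} → Nonempty S → ¬ IsZeroVec (indicator S)
indicator-nonzero (v , v∈S) 1S≡0 =
  1≢0 (trans (cong (λ s → sideVal s 1ℚ) (sym ([]=⇒lookup v∈S))) (1S≡0 v))

sumOver≡indicator· : (S : Subset n) (x : Vector n) → sumOver S x ≡ indicator S · x
sumOver≡indicator· {n} S x =
  trans (sumℚ≡sum n (λ v → sideVal (lookup S v) (x v))) (sum-cong-≗ (λ v → sideVal-scale (lookup S v) (x v)))
  where
  sideVal-scale : ∀ s q → sideVal s q ≡ sideVal s 1ℚ * q
  sideVal-scale inside  q = sym (*-identityˡ q)
  sideVal-scale outside q = sym (*-zeroˡ q)

isRow⇒≡neighbourhood : (G : SimpleGraph n) (S : Subset n) (i : Fin n) →
                       IsRow G (indicator S) i → S ≡ neighbourhood G i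
isRow⇒≡neighbourhood G S i 1S≡Aᵢ =
  trans (sym (tabulate∘lookup S)) (tabulate-cong (λ u → side-reflects (lookup S u) (adj G i u) (1S≡Aᵢ u)))
  where
  side-reflects : ∀ s b → sideVal s 1ℚ ≡ (if b then 1ℚ else 0ℚ) → s ≡ (if b then inside else outside)
  side-reflects inside  true  _ = refl
  side-reflects outside false _ = refl
  side-reflects inside  false ()
  side-reflects outside true  ()

corollary3p5 : {n : ℕ} (G : SimpleGraph n) → NullityOne G →
    (x : Vector n) → ¬ IsZeroVec x → InNullSpace G x →
    (S : Subset n) → Nonempty S → sumOver S x ≡ 0ℚ →
    (∀ (v : Fin n) → ∣ S ∣ ≢ deg G v) →
    ACK G
corollary3p5 G nullityOne x x≢0 x∈N S S≢∅ ΣSx≡0 |S|≢deg =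
  indicator S , indicator-isZeroOne S , indicator-nonzero S≢∅ , 1S∈rowSpace , 1S≢row
  where
  1S⊥x : indicator S · x ≡ 0ℚ
  1S⊥x = trans (sym (sumOver≡indicator· S x)) ΣSx≡0
  1S∈rowSpace : InRowSpace G (indicator S)
  1S∈rowSpace = inRowSpan⇒inRowSpace G (⊥kernel⇒inRowSpan (adjMatrix G) (indicator S) λ z Az≡0 →
    nullityOne⇒⊥nullSpace G nullityOne x≢0 x∈N (indicator S) 1S⊥x z (inKernel⇒inNullSpace G Az≡0))
  1S≢row : ∀ i → ¬ IsRow G (indicator S) i
  1S≢row i 1S≡Aᵢ = |S|≢deg i (cong ∣_∣ (isRow⇒≡neighbourhood G S i 1S≡Aᵢ))
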